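{- Let $K$ be a semifield, $P$ a polygon with vertex set $V$, and $D$ a dissection of $P$ of the form $D=\{d\}\sqcup D_2$, where $d=\{\zeta,\eta\}$ divides $P$ into subpolygons $P_1$ (vertex set $\{\varepsilon\in V : \zeta\le\varepsilon\le\eta\}$) and $P_2$ (vertex set $\{\varepsilon\in V:\eta\le\varepsilon\le\zeta\}$), and $D_2$ is a dissection of $P_2$. If $f:\operatorname{diag}(P)\to K$ satisfies the $T$-path formula with respect to $D$, then $f|_{\operatorname{diag}(P_2)}$ satisfies the $T$-path formula with respect to $D_2$.
   Context: A semifield is a set $K$ with binary operations $+$ and $\cdot$ such that $+$ is associative and commutative, $(K,\cdot)$ is a commutative group, and $\cdot$ distributes over $+$. A polygon $P$ is a finite set $V$ of at least three vertices with a cyclic order, pictured as a convex polygon in the plane; $\zeta\le\varepsilon\le\eta$ means $\varepsilon$ lies on the arc of the cyclic order going from $\zeta$ to $\eta$ in the positive direction (endpoints included). A subpolygon is a subset of $V$ with at least three vertices and the induced cyclic order. A diagonal is a two-element subset of $V$; $\operatorname{diag}(P)$ is the set of diagonals; $f(\alpha,\beta):=f(\{\alpha,\beta\})$. Edges are $\{\alpha,\alpha^+\}$; other diagonals are internal. Diagonals $\{\alpha,\beta\}$, $\{\gamma,\delta\}$ cross if the four vertices are distinct and appear in cyclic order $\alpha,\gamma,\beta,\delta$ or $\alpha,\delta,\beta,\gamma$. A dissection is a set of pairwise non-crossing internal diagonals. For vertices $\pi_1\neq\pi_p$, a $T$-path from $\pi_1$ to $\pi_p$ with respect to $D$ is a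 tuple $(\pi_1,\dots,\pi_p)$ of vertices such that: (i) $\{\pi_1,\pi_2\},\dots,\{\pi_{p-1},\pi_p\}$ are pairwise different diagonals; (ii) no $\{\pi_i,\pi_{i+1}\}$ crosses a diagonal of $D$; (iii) each $\{\pi_{2j},\pi_{2j+1}\}$ lies in $D$, and these diagonals cross $\{\pi_1,\pi_p\}$ at pairwise different points progressing monotonically in the direction from $\pi_1$ to $\pi_p$. $\mathcal{T}_{P,D}(\alpha,\beta)$ is the set of such $T$-paths from $\alpha$ to $\beta$. For a $T$-path $\pi$, $f(\pi) := \prod_{i\text{ odd}} f(\pi_i,\pi_{i+1}) \big/ \prod_{j\text{ even}} f(\pi_j,\pi_{j+1})$. A map $f:\operatorname{diag}(P)\to K$ satisfies the $T$-path formula with respect to $D$ if $f(\alpha,\beta)=\sum_{\pi\in\mathcal{T}_{P,D}(\alpha,\beta)} f(\pi)$ for all vertices $\alpha\neq\beta$ of $P$. -}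

module Defs where

open import Level using (Level; _⊔_) renaming (suc to lsuc)
open import Data.Nat using (ℕ; _<_)
open import Data.Fin using (Fin; toℕ)
open import Data.Product using (Σ; ∃; ∃-syntax; _×_; _,_)
open import Data.Sum using (_⊎_)
open import Data.Unit using (⊤)
open import Data.Maybe using (just)
open import Data.List using (List; []; _∷_; head; last)
open import Data.List.Relation.Unary.All using (All)
open import Data.List.Relation.Unary.Any using (Any)
open import Data.List.Relation.Unary.AllPairs using (AllPairs)
open import Data.List.Relation.Unary.Unique.Propositional using (Unique)
open import Data.List.Membership.Propositional using (_∈_)
open import Relation.Nullary using (¬_)
open import Relation.Binary.PropositionalEquality using (_≡_; _≢_)
open import Algebra.Core using (Op₁; Op₂)
open import Algebra.Structures using (IsCommutativeSemigroup; IsAbelianGroup)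
import Algebra.Definitions as AD

record Semifield (c ℓ : Level) : Set (lsuc (c ⊔ ℓ)) where
  infixl 7 _*_
  infixl 6 _+_
  infix  4 _≈_
  field
    Carrier : Set c
    _≈_     : Carrier → Carrier → Set ℓ
    _+_     : Op₂ Carrier
    _*_     : Op₂ Carrier
    1#      : Carrier
    _⁻¹     : Op₁ Carrier
    +-isCommutativeSemigroup : IsCommutativeSemigroup _≈_ _+_
    *-isAbelianGroup         : IsAbelianGroup _≈_ _*_ 1# _⁻¹
    distrib                  : AD._DistributesOver_ _≈_ _*_ _+_

-- Polygons.  The vertex set of the ambient polygon P is Fin n with the
-- cyclic order 0 < 1 < ... < n-1 < 0.  A subpolygon is given by a
-- predicate S on Fin n (with the induced cyclic order).

Vtx : ℕ → Set
Vtx n = Fin n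

-- strict cyclic betweenness: x lies strictly inside the arc going from
-- a to b in the positive direction
SBtw : ∀ {n} → Fin n → Fin n → Fin n → Set
SBtw a x b =
  (toℕ a < toℕ x × toℕ x < toℕ b) ⊎
  ((toℕ b < toℕ a × toℕ a < toℕ x) ⊎ (toℕ x < toℕ b × toℕ b < toℕ a))

Btw : ∀ {n} → Fin n → Fin n → Fin n → Set
Btw a x b = x ≡ a ⊎ (x ≡ b ⊎ SBtw a x b)

Full : ∀ {n} → Fin n → Set
Full _ = ⊤

Arc : ∀ {n} → Fin n → Fin n → Fin n → Set
Arc a b x = Btw a x b

-- diagonals are represented by ordered pairs, read as unordered
Pair : ℕ → Set
Pair n = Fin n × Fin n

SameDiag : ∀ {n} → Pair n → Pair n → Set
SameDiag (a , b) (c , d) = (a ≡ c × b ≡ d) ⊎ (a ≡ d × b ≡ c)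

InD : ∀ {n} → List (Pair n) → Pair n → Set
InD D e = Any (SameDiag e) D

Cross : ∀ {n} → Pair n → Pair n → Set
Cross (a , b) (c , d) =
  (a ≢ b × a ≢ c × a ≢ d × b ≢ c × b ≢ d × c ≢ d) ×
  ((SBtw a c b × SBtw b d a) ⊎ (SBtw a d b × SBtw b c a))

IsDiag : ∀ {n} → (Fin n → Set) → Pair n → Set
IsDiag S (a , b) = S a × S b × a ≢ b

IsEdge : ∀ {n} → (Fin n → Set) → Pair n → Set
IsEdge S (a , b) = IsDiag S (a , b) ×
  ((∀ x → S x → ¬ SBtw a x b) ⊎ (∀ x → S x → ¬ SBtw b x a))

IsInternal : ∀ {n} → (Fin n → Set) → Pair n → Set
IsInternal S e = IsDiag S e × ¬ IsEdge S e

IsDissection : ∀ {n} → (Fin n → Set) → List (Pair n) → Set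
IsDissection S D =
  All (IsInternal S) D × (∀ e e' → e ∈ D → e' ∈ D → ¬ Cross e e')

steps : ∀ {A : Set} → List A → List (A × A)
steps []           = []
steps (x ∷ [])     = []
steps (x ∷ y ∷ xs) = (x , y) ∷ steps (y ∷ xs)

-- elements at positions 1,3,5,... resp. 2,4,6,... (1-based)
oddPos evenPos : ∀ {A : Set} → List A → List A
oddPos []       = []
oddPos (x ∷ xs) = x ∷ evenPos xs
evenPos []       = []
evenPos (x ∷ xs) = oddPos xs

-- Combinatorial encoding of "e₁ crosses {α,β} strictly before e₂ in the
-- direction from α to β": writing eᵢ = {γᵢ,δᵢ} with γᵢ strictly on the
-- arc α→β and δᵢ strictly on the arc β→α, we have α ≤ γ₁ ≤ γ₂ and
-- β ≤ δ₂ ≤ δ₁ in the cyclic order, and e₁ ≠ e₂.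
Before : ∀ {n} → Fin n → Fin n → Pair n → Pair n → Set
Before α β e₁ e₂ =
  ∃[ γ₁ ] ∃[ δ₁ ] ∃[ γ₂ ] ∃[ δ₂ ]
    SameDiag e₁ (γ₁ , δ₁) × SameDiag e₂ (γ₂ , δ₂) ×
    SBtw α γ₁ β × SBtw β δ₁ α × SBtw α γ₂ β × SBtw β δ₂ α ×
    Btw α γ₁ γ₂ × Btw β δ₂ δ₁ × ¬ SameDiag e₁ e₂

record TPath {n} (S : Fin n → Set) (D : List (Pair n))
             (α β : Fin n) (π : List (Fin n)) : Set where
  field
    starts   : head π ≡ just α
    ends     : last π ≡ just β
    inS      : All S π
    diags    : All (λ { (a , b) → a ≢ b }) (steps π)
    distinct : AllPairs (λ e e' → ¬ SameDiag e e') (steps π)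
    noCross  : All (λ e → All (λ d → ¬ Cross e d) D) (steps π)
    evenInD  : All (InD D) (evenPos (steps π))
    evenCross : All (λ e → Cross e (α , β)) (evenPos (steps π))
    monotone : AllPairs (Before α β) (evenPos (steps π))

module _ {c ℓ} (K : Semifield c ℓ) where
  open Semifield K

  prod : List Carrier → Carrier
  prod []       = 1#
  prod (x ∷ xs) = x * prod xs

  sum⁺ : Carrier → List Carrier → Carrier
  sum⁺ x []       = x
  sum⁺ x (y ∷ ys) = x + sum⁺ y ys

  module _ {n} (f : Fin n → Fin n → Carrier) where

    fDiag : Pair n → Carrier
    fDiag (a , b) = f a b

    map' : List (Pair n) → List Carrier
    map' []       = []
    map' (e ∷ es) = fDiag e ∷ map' es

    weight : List (Fin n) → Carrier
    weight π = prod (map' (oddPos (steps π))) * (prod (map' (evenPos (steps π))) ⁻¹)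

    weights : List (List (Fin n)) → List Carrier
    weights []       = []
    weights (π ∷ πs) = weight π ∷ weights πs

    -- f satisfies the T-path formula on the polygon S w.r.t. D:
    -- for all vertices α ≠ β of S, f(α,β) is the sum of f(π) over the
    -- (finite, nonempty) set of T-paths from α to β, enumerated without
    -- repetition by the list π₀ ∷ πs.
    TFormula : (S : Fin n → Set) → List (Pair n) → Set ℓ
    TFormula S D = ∀ α β → S α → S β → α ≢ β →
      ∃[ π₀ ] ∃[ πs ]
        All (TPath S D α β) (π₀ ∷ πs) ×
        Unique (π₀ ∷ πs) ×
        (∀ π → TPath S D α β π → π ∈ (π₀ ∷ πs)) ×
        (f α β ≈ sum⁺ (weight π₀) (weights πs))

module Submission where

-- For vertices
-- α ≠ β of P₂ we show that the T-paths from α to β in P with respect to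
-- D = {d} ∪ D₂ are exactly the T-paths from α to β in P₂ with respect to D₂.
-- The T-path formula for D at (α,β) then is, verbatim, the T-path formula
-- for D₂ at (α,β): same list of paths, same weights, same value f(α,β).
--
-- Two geometric facts drive the comparison, both consequences of the fact
-- that a diagonal crossing {c,d} has an endpoint strictly on the arc c → d:
--   * no diagonal of P₂ crosses d (so adding d to D₂ forbids nothing new);
--   * d does not cross {α,β} (so d never occurs as an even step of a path).
-- Moreover a T-path w.r.t. D₂ stays inside P₂, since its even steps are
-- diagonals of D₂ and every vertex is an endpoint of an even step, or the
-- start or end of the path.

open import Defs
open import Data.Nat using (ℕ; _≤_)
open import Data.Nat.Properties using (<-irrefl; <-trans; <-asym)
open import Data.Fin using (Fin)
open import Data.Product using (_,_; _×_)
open import Data.Sum using (_⊎_; inj₁; inj₂)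
open import Data.Empty using (⊥-elim)
open import Data.Unit using (tt)
open import Data.Maybe using (just)
open import Data.List using (List; []; _∷_; last)
open import Data.List.Relation.Unary.All using (All; []; _∷_)
import Data.List.Relation.Unary.All as All
open import Data.List.Relation.Unary.Any using (here; there)
open import Relation.Nullary using (¬_)
open import Relation.Binary.PropositionalEquality using (_≡_; refl)

sbtw-rotate : ∀ {n} {a x b : Fin n} → SBtw a x b → SBtw x b a
sbtw-rotate (inj₁ (a<x , x<b))        = inj₂ (inj₁ (a<x , x<b))
sbtw-rotate (inj₂ (inj₁ (b<a , a<x))) = inj₂ (inj₂ (b<a , a<x))
sbtw-rotate (inj₂ (inj₂ (x<b , b<a))) = inj₁ (x<b , b<a)

sbtw-asym : ∀ {n} {a x b : Fin n} → SBtw a x b → ¬ SBtw b x a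
sbtw-asym (inj₁ (a<x , x<b))        (inj₁ (b<x , _))        = <-asym x<b b<x
sbtw-asym (inj₁ (a<x , x<b))        (inj₂ (inj₁ (_ , b<x))) = <-asym x<b b<x
sbtw-asym (inj₁ (a<x , _))          (inj₂ (inj₂ (x<a , _))) = <-asym a<x x<a
sbtw-asym (inj₂ (inj₁ (_ , a<x)))   (inj₁ (_ , x<a))        = <-asym a<x x<a
sbtw-asym (inj₂ (inj₁ (b<a , _)))   (inj₂ (inj₁ (a<b , _))) = <-asym a<b b<a
sbtw-asym (inj₂ (inj₁ (b<a , _)))   (inj₂ (inj₂ (_ , a<b))) = <-asym a<b b<a
sbtw-asym (inj₂ (inj₂ (x<b , _)))   (inj₁ (b<x , _))        = <-asym x<b b<x
sbtw-asym (inj₂ (inj₂ (_ , b<a)))   (inj₂ (inj₁ (a<b , _))) = <-asym a<b b<a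
sbtw-asym (inj₂ (inj₂ (_ , b<a)))   (inj₂ (inj₂ (_ , a<b))) = <-asym a<b b<a

sbtw-trans : ∀ {n} {a b c d : Fin n} → SBtw a b c → SBtw a c d → SBtw a b d
sbtw-trans (inj₁ (a<b , b<c))        (inj₁ (_ , c<d))        = inj₁ (a<b , <-trans b<c c<d)
sbtw-trans (inj₁ (a<b , _))          (inj₂ (inj₁ (d<a , _))) = inj₂ (inj₁ (d<a , a<b))
sbtw-trans (inj₁ (a<b , b<c))        (inj₂ (inj₂ (c<d , d<a))) = ⊥-elim (<-asym (<-trans a<b b<c) (<-trans c<d d<a))
sbtw-trans (inj₂ (inj₁ (c<a , _)))   (inj₁ (a<c , _))        = ⊥-elim (<-asym a<c c<a)
sbtw-trans (inj₂ (inj₁ (_ , a<b)))   (inj₂ (inj₁ (d<a , _))) = inj₂ (inj₁ (d<a , a<b))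
sbtw-trans (inj₂ (inj₁ (_ , a<b)))   (inj₂ (inj₂ (_ , d<a))) = inj₂ (inj₁ (d<a , a<b))
sbtw-trans (inj₂ (inj₂ (_ , c<a)))   (inj₁ (a<c , _))        = ⊥-elim (<-asym a<c c<a)
sbtw-trans (inj₂ (inj₂ (_ , c<a)))   (inj₂ (inj₁ (_ , a<c))) = ⊥-elim (<-asym a<c c<a)
sbtw-trans (inj₂ (inj₂ (b<c , _)))   (inj₂ (inj₂ (c<d , d<a))) = inj₂ (inj₂ (<-trans b<c c<d , d<a))

sbtw-≢-left : ∀ {n} {a b : Fin n} → ¬ SBtw a a b
sbtw-≢-left (inj₁ (a<a , _))        = <-irrefl refl a<a
sbtw-≢-left (inj₂ (inj₁ (_ , a<a))) = <-irrefl refl a<a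
sbtw-≢-left (inj₂ (inj₂ (a<b , b<a))) = <-asym a<b b<a

sbtw-≢-right : ∀ {n} {a b : Fin n} → ¬ SBtw a b b
sbtw-≢-right (inj₁ (_ , b<b))          = <-irrefl refl b<b
sbtw-≢-right (inj₂ (inj₁ (b<a , a<b))) = <-asym a<b b<a
sbtw-≢-right (inj₂ (inj₂ (b<b , _)))   = <-irrefl refl b<b

sbtw-excludes-arc : ∀ {n} {a x b : Fin n} → SBtw a x b → ¬ Btw b x a
sbtw-excludes-arc s (inj₁ refl)        = sbtw-≢-right s
sbtw-excludes-arc s (inj₂ (inj₁ refl)) = sbtw-≢-left s
sbtw-excludes-arc s (inj₂ (inj₂ s'))   = sbtw-asym s s'

EndpointOn : ∀ {n} → Fin n → Fin n → Pair n → Set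
EndpointOn c d (a , b) = SBtw c a d ⊎ SBtw c b d

four-cyclic : ∀ {n} {x y z w : Fin n} → SBtw x y z → SBtw z w x → SBtw y z w
four-cyclic xyz zwx = sbtw-rotate (sbtw-rotate (sbtw-trans zwx (sbtw-rotate (sbtw-rotate xyz))))

crossing-left : ∀ {n} {a b c d : Fin n} → Cross (a , b) (c , d) → EndpointOn c d (a , b)
crossing-left (_ , inj₁ (acb , bda)) = inj₂ (four-cyclic acb bda)
crossing-left (_ , inj₂ (adb , bca)) = inj₁ (four-cyclic bca adb)

crossing-right : ∀ {n} {a b c d : Fin n} → Cross (c , d) (a , b) → EndpointOn c d (a , b)
crossing-right (_ , inj₁ (cad , _)) = inj₁ cad
crossing-right (_ , inj₂ (cbd , _)) = inj₂ cbd

crossing-right-flipped : ∀ {n} {a b c d : Fin n} → Cross (d , c) (a , b) → EndpointOn c d (a , b)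
crossing-right-flipped (_ , inj₁ (_ , cbd)) = inj₂ cbd
crossing-right-flipped (_ , inj₂ (_ , cad)) = inj₁ cad

arc-avoids-opposite : ∀ {n} {η ζ a b : Fin n} →
  Arc η ζ a → Arc η ζ b → ¬ EndpointOn ζ η (a , b)
arc-avoids-opposite a∈ _  (inj₁ s) = sbtw-excludes-arc s a∈
arc-avoids-opposite _  b∈ (inj₂ s) = sbtw-excludes-arc s b∈

arc-diag-not-cross : ∀ {n} {η ζ a b : Fin n} →
  Arc η ζ a → Arc η ζ b → ¬ Cross (a , b) (ζ , η)
arc-diag-not-cross a∈ b∈ x = arc-avoids-opposite a∈ b∈ (crossing-left x)

crossing-arc-diag-not-closing : ∀ {n} {η ζ a b : Fin n} (e : Pair n) →
  Arc η ζ a → Arc η ζ b → Cross e (a , b) → ¬ SameDiag e (ζ , η)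
crossing-arc-diag-not-closing _ a∈ b∈ x (inj₁ (refl , refl)) =
  arc-avoids-opposite a∈ b∈ (crossing-right x)
crossing-arc-diag-not-closing _ a∈ b∈ x (inj₂ (refl , refl)) =
  arc-avoids-opposite a∈ b∈ (crossing-right-flipped x)

Both : ∀ {n} → (Fin n → Set) → Pair n → Set
Both S (a , b) = S a × S b

steps-inside : ∀ {n} {S : Fin n → Set} (π : List (Fin n)) → All S π → All (Both S) (steps π)
steps-inside []           _                = []
steps-inside (x ∷ [])     _                = []
steps-inside (x ∷ y ∷ xs) (x∈ ∷ y∈ ∷ xs∈) = (x∈ , y∈) ∷ steps-inside (y ∷ xs) (y∈ ∷ xs∈)

-- A vertex sequence lies in S as soon as its first and last vertices and
-- the endpoints of its even steps do: every other vertex is an endpoint of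
-- an even step.
inside-from-even-steps : ∀ {n} {S : Fin n → Set} {β : Fin n} (x : Fin n) (π : List (Fin n)) →
  S x → last (x ∷ π) ≡ just β → S β →
  All (Both S) (evenPos (steps (x ∷ π))) → All S (x ∷ π)
inside-from-even-steps x []          x∈ _    _  _                 = x∈ ∷ []
inside-from-even-steps x (y ∷ [])    x∈ refl β∈ _                 = x∈ ∷ β∈ ∷ []
inside-from-even-steps x (y ∷ z ∷ π) x∈ ends β∈ ((y∈ , z∈) ∷ even∈) =
  x∈ ∷ y∈ ∷ inside-from-even-steps z π z∈ ends β∈ even∈

dissection-inside : ∀ {n} {S : Fin n → Set} {e : Pair n} (D : List (Pair n)) →
  All (IsInternal S) D → InD D e → Both S e
dissection-inside (d ∷ D) (((c∈ , d∈ , _) , _) ∷ _) (here (inj₁ (refl , refl))) = c∈ , d∈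
dissection-inside (d ∷ D) (((c∈ , d∈ , _) , _) ∷ _) (here (inj₂ (refl , refl))) = d∈ , c∈
dissection-inside (d ∷ D) (_ ∷ internal) (there e∈D) = dissection-inside D internal e∈D

module TPathsOfArc {n : ℕ} (ζ η : Fin n) (D₂ : List (Pair n))
                   (D₂-internal : All (IsInternal (Arc η ζ)) D₂)
                   {α β : Fin n} (α∈ : Arc η ζ α) (β∈ : Arc η ζ β) where

  D : List (Pair n)
  D = (ζ , η) ∷ D₂

  -- An even step lies in D and crosses {α,β}; since {ζ,η} does not cross
  -- {α,β}, it lies in D₂.
  even-step-in-D₂ : ∀ {e} → InD D e × Cross e (α , β) → InD D₂ e
  even-step-in-D₂ (here e≈d  , x) = ⊥-elim (crossing-arc-diag-not-closing _ α∈ β∈ x e≈d)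
  even-step-in-D₂ (there e∈D₂ , _) = e∈D₂

  no-cross-D : ∀ {e} → Both (Arc η ζ) e × All (λ d → ¬ Cross e d) D₂ →
               All (λ d → ¬ Cross e d) D
  no-cross-D {a , b} ((a∈ , b∈) , noCross₂) = arc-diag-not-cross a∈ b∈ ∷ noCross₂

  restrict : ∀ π → TPath Full D α β π → TPath (Arc η ζ) D₂ α β π
  restrict []      t with TPath.starts t
  ... | ()
  restrict (x ∷ π) t with TPath.starts t
  ... | refl = record
    { starts    = refl
    ; ends      = TPath.ends t
    ; inS       = inside-from-even-steps x π α∈ (TPath.ends t) β∈
                    (All.map (dissection-inside D₂ D₂-internal) evenInD₂)
    ; diags     = TPath.diags t
    ; distinct  = TPath.distinct t
    ; noCross   = All.map All.tail (TPath.noCross t)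
    ; evenInD   = evenInD₂
    ; evenCross = TPath.evenCross t
    ; monotone  = TPath.monotone t
    }
    where
      evenInD₂ : All (InD D₂) (evenPos (steps (x ∷ π)))
      evenInD₂ = All.zipWith even-step-in-D₂ (TPath.evenInD t , TPath.evenCross t)

  extend : ∀ π → TPath (Arc η ζ) D₂ α β π → TPath Full D α β π
  extend π t = record
    { starts    = TPath.starts t
    ; ends      = TPath.ends t
    ; inS       = All.map (λ _ → tt) (TPath.inS t)
    ; diags     = TPath.diags t
    ; distinct  = TPath.distinct t
    ; noCross   = All.zipWith no-cross-D (steps-inside π (TPath.inS t) , TPath.noCross t)
    ; evenInD   = All.map there (TPath.evenInD t)
    ; evenCross = TPath.evenCross t
    ; monotone  = TPath.monotone t
    }

lemma3p5 : ∀ {c ℓ} (K : Semifield c ℓ) (n : ℕ) → 3 ≤ n →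
    (f : Fin n → Fin n → Semifield.Carrier K) →
    (∀ a b → Semifield._≈_ K (f a b) (f b a)) →
    (ζ η : Fin n) (D₂ : List (Pair n)) →
    IsInternal Full (ζ , η) →
    ¬ InD D₂ (ζ , η) →
    IsDissection Full ((ζ , η) ∷ D₂) →
    IsDissection (Arc η ζ) D₂ →
    TFormula K f Full ((ζ , η) ∷ D₂) →
    TFormula K f (Arc η ζ) D₂
lemma3p5 K n _ f _ ζ η D₂ _ _ _ (D₂-internal , _) formula α β α∈ β∈ α≢β
  with formula α β tt tt α≢β
... | π₀ , πs , areTPaths , unique , complete , value =
  π₀ , πs , All.map (restrict _) areTPaths , unique ,
  (λ π t → complete π (extend π t)) , value
  where open TPathsOfArc ζ η D₂ D₂-internal α∈ β∈
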